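{- Let $k=2$ and $\sigma\ge3$. The shortest $(2,\sigma)$-covering string has length $\binom{\sigma+1}{2}+1$ if $\sigma$ is odd, and $\binom{\sigma+1}{2}+\sigma/2$ if $\sigma$ is even. Consequently, for odd $\sigma$ a $(2,\sigma)$-PdB-string exists, and for even $\sigma$ the minimal excess of a $(2,\sigma)$-covering string is $\sigma/2-1$.
   Context: Let $\Sigma=\{a_1<\dots<a_\sigma\}$. For a string $u$, $\mathbf{pv}(u)\in\mathbb{N}^\sigma$ has $i$-th entry the number of occurrences of $a_i$ in $u$; the order of a Parikh vector is the sum of its entries. A string $w$ over $\Sigma$ is $(k,\sigma)$-covering if for every Parikh vector $p$ of order $k$ there is a substring $u$ of $w$ with $\mathbf{pv}(u)=p$; it is a $(k,\sigma)$-PdB-string if for every such $p$ there is exactly one occurrence of a length-$k$ substring with Parikh vector $p$. The excess of a $(k,\sigma)$-covering string $w$ is $|w|-\left(\binom{\sigma+k-1}{k}+k-1\right)$. -}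

module Defs where

open import Data.Nat using (ℕ; zero; suc; _+_; _*_; _∸_; _≤_)
open import Data.Nat.Combinatorics using (_C_)
open import Data.Fin using (Fin; _≟_)
open import Data.List using (List; length; _++_; take; drop; filter)
open import Data.Vec using (Vec; tabulate)
import Data.Vec as Vec
open import Data.Integer using (ℤ; +_; _-_)
open import Data.Product using (Σ; ∃; _×_)
open import Relation.Binary.PropositionalEquality using (_≡_)

Str : ℕ → Set
Str σ = List (Fin σ)

pv : ∀ {σ} → Str σ → Vec ℕ σ
pv u = tabulate (λ i → length (filter (i ≟_) u))

order : ∀ {σ} → Vec ℕ σ → ℕ
order = Vec.sum

Substring : ∀ {σ} → Str σ → Str σ → Set
Substring u w = ∃ λ xs → ∃ λ ys → w ≡ xs ++ (u ++ ys)

Covering : (k σ : ℕ) → Str σ → Set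
Covering k σ w = (p : Vec ℕ σ) → order p ≡ k →
  Σ (Str σ) (λ u → Substring u w × pv u ≡ p)

OccAt : ∀ {σ} (k : ℕ) → Str σ → Vec ℕ σ → ℕ → Set
OccAt k w p i = (i + k ≤ length w) × (pv (take k (drop i w)) ≡ p)

PdB : (k σ : ℕ) → Str σ → Set
PdB k σ w = (p : Vec ℕ σ) → order p ≡ k →
  Σ ℕ (λ i → OccAt k w p i × ((j : ℕ) → OccAt k w p j → j ≡ i))

excess : (k σ : ℕ) → Str σ → ℤ
excess k σ w = + length w - + (((σ + k ∸ 1) C k) + k ∸ 1)

ShortestCoveringLength : (k σ L : ℕ) → Set
ShortestCoveringLength k σ L =
  (Σ (Str σ) (λ w → Covering k σ w × length w ≡ L)) ×
  ((w : Str σ) → Covering k σ w → L ≤ length w)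

MinimalExcess : (k σ : ℕ) → ℤ → Set
MinimalExcess k σ e =
  (Σ (Str σ) (λ w → Covering k σ w × excess k σ w ≡ e)) ×
  ((w : Str σ) → Covering k σ w → e Data.Integer.≤ excess k σ w)

module Submission where

-- A string covers every Parikh vector of order 2 iff any two letters a, b
-- (possibly equal) are adjacent somewhere in it. Let the degree of a letter a
-- be the number of occurrences of a in the |w| - 1 windows of length two;
-- the degrees sum to 2 (|w| - 1). A letter must be adjacent to each of the
-- other σ - 1 letters and to itself, the latter contributing 2, so every
-- degree is at least σ + 1 and 2 (|w| - 1) ≥ σ (σ + 1). When this bound is
-- attained no two windows can share a Parikh vector, which is the PdB
-- property. Since an occurrence lies in at most two windows, every letter
-- occurs at least (σ + 1) / 2 times; for σ = 2m this is m + 1 times, so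
-- |w| ≥ 2m (m + 1). Both bounds are attained by recursive constructions:
-- shift an optimal string by two letters, prefix 0 0 1 1 and append
-- 0 a₁ 1 b₁ 0 a₂ 1 b₂ 0 ⋯ 0, which makes 0 and 1 adjacent to all new letters.

open import Defs
open import Data.Nat using (ℕ; zero; suc; _+_; _*_; _∸_; _≤_; _<_; z≤n; s≤s)
open import Data.Nat.Properties hiding (_≟_)
open import Data.Nat.Properties using () renaming (_≟_ to _≟ℕ_)
open import Data.Nat.Tactic.RingSolver using (solve-∀)
open import Data.Nat.Combinatorics using (_C_; nCk+nC[k+1]≡[n+1]C[k+1]; nC1≡n)
import Data.Integer as ℤ
import Data.Integer.Properties as ℤ
open import Algebra.Properties.Semiring.Sum +-*-semiring
  using (sum; sum-syntax; ∑-distrib-+; *-distribˡ-sum; sum-cong-≗)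
open import Data.Bool using (if_then_else_)
open import Data.Product using (Σ; ∃; ∃₂; _×_; _,_; proj₁; proj₂)
import Data.Product as Product
open import Data.Sum using (_⊎_; inj₁; inj₂; swap)
import Data.Sum as Sum
open import Data.Fin using (Fin; zero; suc; _≟_; _↑ʳ_)
open import Data.List using (List; []; _∷_; length; _++_; filter; map)
open import Data.List.Properties using (++-assoc; map-++; length-map; length-++)
open import Data.Vec using (Vec; tabulate) renaming ([] to []ᵥ; _∷_ to _∷ᵥ_)
import Data.Vec as Vec
import Data.Vec.Properties as Vec
open import Data.Empty using (⊥-elim)
open import Relation.Binary.Definitions using (tri<; tri≈; tri>)
open import Function using (_∘_)
open import Relation.Nullary using (¬_; yes; no; does)
open import Relation.Binary.PropositionalEquality

∑-const : ∀ n c → ∑[ i < n ] c ≡ n * c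
∑-const zero    c = refl
∑-const (suc n) c = cong (c +_) (∑-const n c)

∑-zero : ∀ n → ∑[ i < n ] 0 ≡ 0
∑-zero n = trans (∑-const n 0) (*-zeroʳ n)

∑-mono-≤ : ∀ {n} {f g : Fin n → ℕ} → (∀ i → g i ≤ f i) → ∑[ i < n ] g i ≤ ∑[ i < n ] f i
∑-mono-≤ {zero}  g≤f = z≤n
∑-mono-≤ {suc n} g≤f = +-mono-≤ (g≤f zero) (∑-mono-≤ (g≤f ∘ suc))

∑-bump : ∀ {n} {f g : Fin n → ℕ} {d} → (∀ i → g i ≤ f i) →
         (k : Fin n) → d + g k ≤ f k → d + ∑[ i < n ] g i ≤ ∑[ i < n ] f i
∑-bump {suc n} {f} {g} {d} g≤f zero bump = begin
  d + (g zero + ∑[ i < n ] g (suc i)) ≡⟨ +-assoc d _ _ ⟨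
  d + g zero + ∑[ i < n ] g (suc i)   ≤⟨ +-mono-≤ bump (∑-mono-≤ (g≤f ∘ suc)) ⟩
  f zero + ∑[ i < n ] f (suc i)       ∎
  where open ≤-Reasoning
∑-bump {suc n} {f} {g} {d} g≤f (suc k) bump = begin
  d + (g zero + ∑[ i < n ] g (suc i)) ≡⟨ x+[y+z]≡y+[x+z] d (g zero) _ ⟩
  g zero + (d + ∑[ i < n ] g (suc i)) ≤⟨ +-mono-≤ (g≤f zero) (∑-bump (g≤f ∘ suc) k bump) ⟩
  f zero + ∑[ i < n ] f (suc i)       ∎
  where
  open ≤-Reasoning
  x+[y+z]≡y+[x+z] : ∀ x y z → x + (y + z) ≡ y + (x + z)
  x+[y+z]≡y+[x+z] = solve-∀

δ : ∀ {σ} → Fin σ → Fin σ → ℕ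
δ i x = if does (i ≟ x) then 1 else 0

δ-refl : ∀ {σ} (i : Fin σ) → δ i i ≡ 1
δ-refl i with i ≟ i
... | yes _   = refl
... | no i≢i = ⊥-elim (i≢i refl)

δ-≢ : ∀ {σ} {i x : Fin σ} → i ≢ x → δ i x ≡ 0
δ-≢ {i = i} {x} i≢x with i ≟ x
... | yes i≡x = ⊥-elim (i≢x i≡x)
... | no _    = refl

δ-comm : ∀ {σ} (i x : Fin σ) → δ i x ≡ δ x i
δ-comm i x with i ≟ x
... | yes refl = sym (δ-refl i)
... | no i≢x   = sym (δ-≢ (i≢x ∘ sym))

δ-pos : ∀ {σ} {i x : Fin σ} → 1 ≤ δ i x → i ≡ x
δ-pos {i = i} {x} 1≤δ with i ≟ x
... | yes i≡x = i≡x
δ-pos () | no _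

∑-δ : ∀ {n} (x : Fin n) → ∑[ i < n ] δ i x ≡ 1
∑-δ {suc n} zero    = cong suc (∑-zero n)
∑-δ {suc n} (suc x) = ∑-δ x

∑-δ+δ : ∀ {n} (x y : Fin n) → ∑[ i < n ] (δ i x + δ i y) ≡ 2
∑-δ+δ x y = trans (∑-distrib-+ (λ i → δ i x) (λ i → δ i y)) (cong₂ _+_ (∑-δ x) (∑-δ y))

count : ∀ {σ} → Fin σ → Str σ → ℕ
count i u = length (filter (i ≟_) u)

count-∷ : ∀ {σ} (i x : Fin σ) u → count i (x ∷ u) ≡ δ i x + count i u
count-∷ i x u with i ≟ x
... | yes _ = refl
... | no _  = refl

∑-count : ∀ {σ} (u : Str σ) → ∑[ i < σ ] count i u ≡ length u
∑-count {σ} []      = ∑-zero σ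
∑-count {σ} (x ∷ u) = begin
  ∑[ i < σ ] count i (x ∷ u)              ≡⟨ sum-cong-≗ (λ i → count-∷ i x u) ⟩
  ∑[ i < σ ] (δ i x + count i u)          ≡⟨ ∑-distrib-+ (λ i → δ i x) (λ i → count i u) ⟩
  ∑[ i < σ ] δ i x + ∑[ i < σ ] count i u ≡⟨ cong₂ _+_ (∑-δ x) (∑-count u) ⟩
  suc (length u)                           ∎
  where open ≡-Reasoning

sum-tabulate : ∀ {n} (f : Fin n → ℕ) → Vec.sum (tabulate f) ≡ ∑[ i < n ] f i
sum-tabulate {zero}  f = refl
sum-tabulate {suc n} f = cong (f zero +_) (sum-tabulate (f ∘ suc))

order-pv : ∀ {σ} (u : Str σ) → order (pv u) ≡ length u
order-pv u = trans (sum-tabulate (λ i → count i u)) (∑-count u)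

lookup-pv : ∀ {σ} (u : Str σ) i → Vec.lookup (pv u) i ≡ count i u
lookup-pv u = Vec.lookup∘tabulate (λ i → count i u)

count-pair : ∀ {σ} (i x y : Fin σ) → count i (x ∷ y ∷ []) ≡ δ i x + δ i y
count-pair i x y =
  trans (count-∷ i x (y ∷ [])) (cong (δ i x +_) (trans (count-∷ i y []) (+-identityʳ (δ i y))))

pv-pair-comm : ∀ {σ} (x y : Fin σ) → pv (x ∷ y ∷ []) ≡ pv (y ∷ x ∷ [])
pv-pair-comm x y = Vec.tabulate-cong λ i →
  trans (count-pair i x y) (trans (+-comm (δ i x) (δ i y)) (sym (count-pair i y x)))

δ-injective : ∀ {σ} {y b : Fin σ} → (∀ i → δ i y ≡ δ i b) → y ≡ b
δ-injective {y = y} eq = δ-pos (subst (1 ≤_) (trans (sym (δ-refl y)) (eq y)) ≤-refl)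

pv-pair-δ : ∀ {σ} {x y a b : Fin σ} → pv (x ∷ y ∷ []) ≡ pv (a ∷ b ∷ []) →
            ∀ i → δ i x + δ i y ≡ δ i a + δ i b
pv-pair-δ {x = x} {y} {a} {b} eq i = begin
  δ i x + δ i y                  ≡⟨ count-pair i x y ⟨
  count i (x ∷ y ∷ [])           ≡⟨ lookup-pv (x ∷ y ∷ []) i ⟨
  Vec.lookup (pv (x ∷ y ∷ [])) i ≡⟨ cong (λ v → Vec.lookup v i) eq ⟩
  Vec.lookup (pv (a ∷ b ∷ [])) i ≡⟨ lookup-pv (a ∷ b ∷ []) i ⟩
  count i (a ∷ b ∷ [])           ≡⟨ count-pair i a b ⟩
  δ i a + δ i b                  ∎
  where open ≡-Reasoning

pv-pair-injective : ∀ {σ} {x y a b : Fin σ} → pv (x ∷ y ∷ []) ≡ pv (a ∷ b ∷ []) →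
                    (x ≡ a × y ≡ b) ⊎ (x ≡ b × y ≡ a)
pv-pair-injective {x = x} {y} {a} {b} eq with x ≟ a
... | yes refl = inj₁ (refl , δ-injective λ i → +-cancelˡ-≡ (δ i x) _ _ (pv-pair-δ eq i))
... | no x≢a   = inj₂ (x≡b , δ-injective λ i → +-cancelʳ-≡ (δ i x) _ _ (begin
      δ i y + δ i x ≡⟨ +-comm (δ i y) (δ i x) ⟩
      δ i x + δ i y ≡⟨ pv-pair-δ eq i ⟩
      δ i a + δ i b ≡⟨ cong (λ z → δ i a + δ i z) x≡b ⟨
      δ i a + δ i x ∎))
  where
  open ≡-Reasoning
  x≡b : x ≡ b
  x≡b = δ-pos (subst (1 ≤_) (begin
    1 + δ x y     ≡⟨ cong (_+ δ x y) (δ-refl x) ⟨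
    δ x x + δ x y ≡⟨ pv-pair-δ eq x ⟩
    δ x a + δ x b ≡⟨ cong (_+ δ x b) (δ-≢ x≢a) ⟩
    δ x b         ∎) (m≤m+n 1 (δ x y)))

count-map-suc : ∀ {n} (k : Fin n) (u : Str n) → count (suc k) (map suc u) ≡ count k u
count-map-suc k []      = refl
count-map-suc k (y ∷ u) = begin
  count (suc k) (suc y ∷ map suc u) ≡⟨ count-∷ (suc k) (suc y) (map suc u) ⟩
  δ k y + count (suc k) (map suc u) ≡⟨ cong (δ k y +_) (count-map-suc k u) ⟩
  δ k y + count k u                 ≡⟨ count-∷ k y u ⟨
  count k (y ∷ u)                   ∎
  where open ≡-Reasoning

count-zero-map-suc : ∀ {n} (u : Str n) → count zero (map suc u) ≡ 0
count-zero-map-suc []      = refl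
count-zero-map-suc (y ∷ u) = count-zero-map-suc u

pv-map-suc : ∀ {n} (u : Str n) → pv (map suc u) ≡ 0 ∷ᵥ pv u
pv-map-suc u = cong₂ _∷ᵥ_ (count-zero-map-suc u) (Vec.tabulate-cong λ k → count-map-suc k u)

order≡0⇒pv[] : ∀ {σ} (p : Vec ℕ σ) → order p ≡ 0 → pv [] ≡ p
order≡0⇒pv[] []ᵥ       _  = refl
order≡0⇒pv[] (0 ∷ᵥ p) eq = cong (0 ∷ᵥ_) (order≡0⇒pv[] p eq)

order≡1⇒pv-letter : ∀ {σ} (p : Vec ℕ σ) → order p ≡ 1 → ∃ λ j → pv (j ∷ []) ≡ p
order≡1⇒pv-letter (0 ∷ᵥ p) eq with order≡1⇒pv-letter p eq
... | j , pv≡p = suc j , trans (pv-map-suc (j ∷ [])) (cong (0 ∷ᵥ_) pv≡p)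
order≡1⇒pv-letter (1 ∷ᵥ p) eq = zero , cong (1 ∷ᵥ_) (order≡0⇒pv[] p (suc-injective eq))

order≡2⇒pv-pair : ∀ {σ} (p : Vec ℕ σ) → order p ≡ 2 → ∃₂ λ i j → pv (i ∷ j ∷ []) ≡ p
order≡2⇒pv-pair (0 ∷ᵥ p) eq with order≡2⇒pv-pair p eq
... | i , j , pv≡p = suc i , suc j , trans (pv-map-suc (i ∷ j ∷ [])) (cong (0 ∷ᵥ_) pv≡p)
order≡2⇒pv-pair (1 ∷ᵥ p) eq with order≡1⇒pv-letter p (suc-injective eq)
... | j , pv≡p = zero , suc j , cong (λ v → suc (Vec.head v) ∷ᵥ Vec.tail v)
                                     (trans (pv-map-suc (j ∷ [])) (cong (0 ∷ᵥ_) pv≡p))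
order≡2⇒pv-pair (2 ∷ᵥ p) eq =
  zero , zero , cong (2 ∷ᵥ_) (order≡0⇒pv[] p (suc-injective (suc-injective eq)))

pv≡order2⇒pair : ∀ {σ} (u : Str σ) {p} → pv u ≡ p → order p ≡ 2 → ∃₂ λ x y → u ≡ x ∷ y ∷ []
pv≡order2⇒pair u pv≡p order≡2 with u | trans (sym (order-pv u)) (trans (cong order pv≡p) order≡2)
... | x ∷ y ∷ [] | _ = x , y , refl

-- Covering for k = 2 as adjacency of all pairs of letters

Adjacent : ∀ {σ} → Fin σ → Fin σ → Str σ → Set
Adjacent a b w = Substring (a ∷ b ∷ []) w ⊎ Substring (b ∷ a ∷ []) w

adjacent-comm : ∀ {σ} {a b : Fin σ} {w} → Adjacent a b w → Adjacent b a w
adjacent-comm = swap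

adjacent⇒covering : ∀ {σ} (w : Str σ) → (∀ a b → Adjacent a b w) → Covering 2 σ w
adjacent⇒covering w adj p order≡2 with order≡2⇒pv-pair p order≡2
... | a , b , pv≡p with adj a b
...   | inj₁ ab = a ∷ b ∷ [] , ab , pv≡p
...   | inj₂ ba = b ∷ a ∷ [] , ba , trans (pv-pair-comm b a) pv≡p

covering⇒adjacent : ∀ {σ} {w : Str σ} → Covering 2 σ w → ∀ a b → Adjacent a b w
covering⇒adjacent cov a b with cov (pv (a ∷ b ∷ [])) (order-pv (a ∷ b ∷ []))
... | u , u⊑w , pv≡ with pv≡order2⇒pair u pv≡ (order-pv (a ∷ b ∷ []))
...   | x , y , refl with pv-pair-injective pv≡
...     | inj₁ (refl , refl) = inj₁ u⊑w
...     | inj₂ (refl , refl) = inj₂ u⊑w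

module _ {A : Set} where

  windowSum : (A → A → ℕ) → List A → ℕ
  windowSum ω (x ∷ y ∷ r) = ω x y + windowSum ω (y ∷ r)
  windowSum ω _           = 0

  data WindowAt : ℕ → List A → A → A → Set where
    here  : ∀ {x y r} → WindowAt 0 (x ∷ y ∷ r) x y
    there : ∀ {i z w x y} → WindowAt i w x y → WindowAt (suc i) (z ∷ w) x y

  windowSum-cong : ∀ {ω ω′} → (∀ x y → ω x y ≡ ω′ x y) → ∀ w → windowSum ω w ≡ windowSum ω′ w
  windowSum-cong ω≗ω′ (x ∷ y ∷ r) = cong₂ _+_ (ω≗ω′ x y) (windowSum-cong ω≗ω′ (y ∷ r))
  windowSum-cong ω≗ω′ []          = refl
  windowSum-cong ω≗ω′ (x ∷ [])    = refl

  windowSum-+ : ∀ ω ω′ w → windowSum (λ x y → ω x y + ω′ x y) w ≡ windowSum ω w + windowSum ω′ w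
  windowSum-+ ω ω′ (x ∷ y ∷ r) = begin
    ω x y + ω′ x y + windowSum (λ x y → ω x y + ω′ x y) (y ∷ r)
      ≡⟨ cong (ω x y + ω′ x y +_) (windowSum-+ ω ω′ (y ∷ r)) ⟩
    ω x y + ω′ x y + (windowSum ω (y ∷ r) + windowSum ω′ (y ∷ r))
      ≡⟨ +-+-comm (ω x y) (ω′ x y) _ _ ⟩
    ω x y + windowSum ω (y ∷ r) + (ω′ x y + windowSum ω′ (y ∷ r)) ∎
    where
    open ≡-Reasoning
    +-+-comm : ∀ a b c d → a + b + (c + d) ≡ a + c + (b + d)
    +-+-comm = solve-∀
  windowSum-+ ω ω′ []       = refl
  windowSum-+ ω ω′ (x ∷ []) = refl

  windowSum-zero : ∀ w → windowSum (λ _ _ → 0) w ≡ 0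
  windowSum-zero (x ∷ y ∷ r) = windowSum-zero (y ∷ r)
  windowSum-zero []          = refl
  windowSum-zero (x ∷ [])    = refl

  windowSum-∑ : ∀ {n} (ω : Fin n → A → A → ℕ) w →
                windowSum (λ x y → ∑[ j < n ] ω j x y) w ≡ ∑[ j < n ] windowSum (ω j) w
  windowSum-∑ {zero}  ω w = windowSum-zero w
  windowSum-∑ {suc n} ω w =
    trans (windowSum-+ (ω zero) (λ x y → ∑[ j < n ] ω (suc j) x y) w)
          (cong (windowSum (ω zero) w +_) (windowSum-∑ (ω ∘ suc) w))

  windowSum-const : ∀ c x r → windowSum (λ _ _ → c) (x ∷ r) ≡ c * length r
  windowSum-const c x []      = sym (*-zeroʳ c)
  windowSum-const c x (y ∷ r) = trans (cong (c +_) (windowSum-const c y r)) (sym (*-suc c (length r)))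

  windowSum-∷ : ∀ ω x w → windowSum ω w ≤ windowSum ω (x ∷ w)
  windowSum-∷ ω x []      = z≤n
  windowSum-∷ ω x (y ∷ r) = m≤n+m _ _

  windowSum-at : ∀ ω {i w x y} → WindowAt i w x y → ω x y ≤ windowSum ω w
  windowSum-at ω here                 = m≤m+n _ _
  windowSum-at ω (there {z = z} {w} at) = ≤-trans (windowSum-at ω at) (windowSum-∷ ω z w)

  windowSum-at₂ : ∀ ω {i j w x y x′ y′} → i < j → WindowAt i w x y → WindowAt j w x′ y′ →
                  ω x y + ω x′ y′ ≤ windowSum ω w
  windowSum-at₂ ω {x = x} {y} _ here (there at′) = +-monoʳ-≤ (ω x y) (windowSum-at ω at′)
  windowSum-at₂ ω (s≤s i<j) (there {z = z} {w} at) (there at′) =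
    ≤-trans (windowSum-at₂ ω i<j at at′) (windowSum-∷ ω z w)

  Window± : ℕ → List A → A → A → Set
  Window± i w x y = WindowAt i w x y ⊎ WindowAt i w y x

  Repeated : A → A → List A → Set
  Repeated x y w = ∃₂ λ i j → i < j × Window± i w x y × Window± j w x y

  module _ {ω : A → A → ℕ} (ω-comm : ∀ x y → ω x y ≡ ω y x) where

    window±-weight : ∀ {i w x y} → Window± i w x y → ∃₂ λ x′ y′ → WindowAt i w x′ y′ × ω x′ y′ ≡ ω x y
    window±-weight (inj₁ at) = _ , _ , at , refl
    window±-weight (inj₂ at) = _ , _ , at , ω-comm _ _

    windowSum-at± : ∀ {i w x y} → Window± i w x y → ω x y ≤ windowSum ω w
    windowSum-at± {i} {w} at± with window±-weight at±
    ... | _ , _ , at , eq = subst (_≤ windowSum ω w) eq (windowSum-at ω at)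

    windowSum-repeated : ∀ {x y w} → Repeated x y w → ω x y + ω x y ≤ windowSum ω w
    windowSum-repeated {w = w} (i , j , i<j , at±ᵢ , at±ⱼ)
      with window±-weight at±ᵢ | window±-weight at±ⱼ
    ... | _ , _ , atᵢ , eqᵢ | _ , _ , atⱼ , eqⱼ =
      subst₂ (λ u v → u + v ≤ windowSum ω w) eqᵢ eqⱼ (windowSum-at₂ ω i<j atᵢ atⱼ)

  windowAt-++ : ∀ xs {x y ys} → WindowAt (length xs) (xs ++ x ∷ y ∷ ys) x y
  windowAt-++ []       = here
  windowAt-++ (z ∷ xs) = there (windowAt-++ xs)

windowAt⇒occAt : ∀ {σ i} {w : Str σ} {x y} → WindowAt i w x y → OccAt 2 w (pv (x ∷ y ∷ [])) i
windowAt⇒occAt here       = s≤s (s≤s z≤n) , refl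
windowAt⇒occAt (there at) with windowAt⇒occAt at
... | i+2≤∣w∣ , pv≡ = s≤s i+2≤∣w∣ , pv≡

occAt⇒windowAt : ∀ {σ i} {w : Str σ} {p} → OccAt 2 w p i →
                 ∃₂ λ x y → WindowAt i w x y × pv (x ∷ y ∷ []) ≡ p
occAt⇒windowAt {i = zero}  {x ∷ y ∷ r} (_ , pv≡p)        = x , y , here , pv≡p
occAt⇒windowAt {i = zero}  {x ∷ []}    (s≤s () , _)
occAt⇒windowAt {i = suc i} {z ∷ w}     (s≤s i+2≤∣w∣ , pv≡p)
  with occAt⇒windowAt {i = i} {w} (i+2≤∣w∣ , pv≡p)
... | x , y , at , pv≡p′ = x , y , there at , pv≡p′

same-pv⇒window± : ∀ {σ i} {w : Str σ} {x y x′ y′} → WindowAt i w x′ y′ →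
                  pv (x′ ∷ y′ ∷ []) ≡ pv (x ∷ y ∷ []) → Window± i w x y
same-pv⇒window± at pv≡ with pv-pair-injective pv≡
... | inj₁ (refl , refl) = inj₁ at
... | inj₂ (refl , refl) = inj₂ at

same-pv⇒repeated : ∀ {σ i j} {w : Str σ} {x y x′ y′} → i ≢ j → WindowAt i w x y → WindowAt j w x′ y′ →
                   pv (x′ ∷ y′ ∷ []) ≡ pv (x ∷ y ∷ []) → Repeated x y w
same-pv⇒repeated {i = i} {j} i≢j at at′ pv≡ with <-cmp i j
... | tri< i<j _ _ = i , j , i<j , inj₁ at , same-pv⇒window± at′ pv≡
... | tri≈ _ i≡j _ = ⊥-elim (i≢j i≡j)
... | tri> _ _ j<i = j , i , j<i , same-pv⇒window± at′ pv≡ , inj₁ at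

adjacent⇒window± : ∀ {σ} {a b : Fin σ} {w} → Adjacent a b w → ∃ λ i → Window± i w a b
adjacent⇒window± (inj₁ (xs , ys , refl)) = length xs , inj₁ (windowAt-++ xs)
adjacent⇒window± (inj₂ (xs , ys , refl)) = length xs , inj₂ (windowAt-++ xs)

-- The window x y counts as an occurrence of the pair {a, b}, the window a a
-- counting twice, so that degree a = ∑ b, pairCount a b.
pairWeight : ∀ {σ} → Fin σ → Fin σ → Fin σ → Fin σ → ℕ
pairWeight a b x y = δ a x * δ b y + δ a y * δ b x

pairCount : ∀ {σ} → Fin σ → Fin σ → Str σ → ℕ
pairCount a b = windowSum (pairWeight a b)

degree : ∀ {σ} → Fin σ → Str σ → ℕ
degree a = windowSum (λ x y → δ a x + δ a y)

pairWeight-comm : ∀ {σ} (a b x y : Fin σ) → pairWeight a b x y ≡ pairWeight a b y x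
pairWeight-comm a b x y = +-comm (δ a x * δ b y) (δ a y * δ b x)

pairWeight-diag : ∀ {σ} (a b : Fin σ) → pairWeight a b a b ≡ 1 + δ b a
pairWeight-diag a b with a ≟ b
... | yes refl rewrite δ-refl a = refl
... | no a≢b   rewrite δ-refl a | δ-refl b | δ-≢ (a≢b ∘ sym) = refl

∑-pairWeight : ∀ {σ} (a x y : Fin σ) → ∑[ b < σ ] pairWeight a b x y ≡ δ a x + δ a y
∑-pairWeight {σ} a x y = begin
  ∑[ b < σ ] (δ a x * δ b y + δ a y * δ b x)
    ≡⟨ ∑-distrib-+ (λ b → δ a x * δ b y) (λ b → δ a y * δ b x) ⟩
  ∑[ b < σ ] (δ a x * δ b y) + ∑[ b < σ ] (δ a y * δ b x)
    ≡⟨ cong₂ _+_ (*-distribˡ-sum (δ a x) (λ b → δ b y)) (*-distribˡ-sum (δ a y) (λ b → δ b x)) ⟨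
  δ a x * ∑[ b < σ ] δ b y + δ a y * ∑[ b < σ ] δ b x
    ≡⟨ cong₂ (λ s t → δ a x * s + δ a y * t) (∑-δ y) (∑-δ x) ⟩
  δ a x * 1 + δ a y * 1
    ≡⟨ cong₂ _+_ (*-identityʳ (δ a x)) (*-identityʳ (δ a y)) ⟩
  δ a x + δ a y ∎
  where open ≡-Reasoning

degree≡∑pairCount : ∀ {σ} (a : Fin σ) w → degree a w ≡ ∑[ b < σ ] pairCount a b w
degree≡∑pairCount a w =
  trans (windowSum-cong (λ x y → sym (∑-pairWeight a x y)) w) (windowSum-∑ (pairWeight a) w)

∑-degree : ∀ {σ} (x : Fin σ) r → ∑[ a < σ ] degree a (x ∷ r) ≡ 2 * length r
∑-degree {σ} x r = begin
  ∑[ a < σ ] degree a (x ∷ r)                            ≡⟨ windowSum-∑ (λ a u v → δ a u + δ a v) (x ∷ r) ⟨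
  windowSum (λ u v → ∑[ a < σ ] (δ a u + δ a v)) (x ∷ r) ≡⟨ windowSum-cong ∑-δ+δ (x ∷ r) ⟩
  windowSum (λ _ _ → 2) (x ∷ r)                          ≡⟨ windowSum-const 2 x r ⟩
  2 * length r                                           ∎
  where open ≡-Reasoning

degree≤2*count : ∀ {σ} (a : Fin σ) w → degree a w ≤ 2 * count a w
degree≤2*count a []      = z≤n
degree≤2*count a (x ∷ r) = ≤-trans (m≤m+n _ (δ a x)) (with-head x r)
  where
  with-head : ∀ x r → degree a (x ∷ r) + δ a x ≤ 2 * count a (x ∷ r)
  with-head x []      = begin
    δ a x               ≤⟨ m≤m+n (δ a x) _ ⟩
    2 * δ a x           ≡⟨ cong (2 *_) (trans (count-∷ a x []) (+-identityʳ (δ a x))) ⟨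
    2 * count a (x ∷ []) ∎
    where open ≤-Reasoning
  with-head x (y ∷ r) = begin
    δ a x + δ a y + degree a (y ∷ r) + δ a x ≡⟨ rearrange (δ a x) (δ a y) (degree a (y ∷ r)) ⟩
    2 * δ a x + (degree a (y ∷ r) + δ a y) ≤⟨ +-monoʳ-≤ (2 * δ a x) (with-head y r) ⟩
    2 * δ a x + 2 * count a (y ∷ r)        ≡⟨ *-distribˡ-+ 2 (δ a x) (count a (y ∷ r)) ⟨
    2 * (δ a x + count a (y ∷ r))          ≡⟨ cong (2 *_) (count-∷ a x (y ∷ r)) ⟨
    2 * count a (x ∷ y ∷ r)                ∎
    where
    open ≤-Reasoning
    rearrange : ∀ u v d → u + v + d + u ≡ 2 * u + (d + v)
    rearrange = solve-∀

-- Lower bounds for covering strings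

∑-1+δ : ∀ {σ} (a : Fin σ) → ∑[ b < σ ] (1 + δ b a) ≡ σ + 1
∑-1+δ {σ} a =
  trans (∑-distrib-+ (λ _ → 1) (λ b → δ b a)) (cong₂ _+_ (trans (∑-const σ 1) (*-identityʳ σ)) (∑-δ a))

pairCount-adjacent : ∀ {σ} {a b : Fin σ} {w} → Adjacent a b w → 1 + δ b a ≤ pairCount a b w
pairCount-adjacent {a = a} {b} {w} adj =
  subst (_≤ pairCount a b w) (pairWeight-diag a b)
        (windowSum-at± (pairWeight-comm a b) (proj₂ (adjacent⇒window± adj)))

degree-covering : ∀ {σ} {w : Str σ} → Covering 2 σ w → ∀ a → σ + 1 ≤ degree a w
degree-covering {σ} {w} cov a = begin
  σ + 1                          ≡⟨ ∑-1+δ a ⟨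
  ∑[ b < σ ] (1 + δ b a)         ≤⟨ ∑-mono-≤ (λ b → pairCount-adjacent (covering⇒adjacent cov a b)) ⟩
  ∑[ b < σ ] pairCount a b w     ≡⟨ degree≡∑pairCount a w ⟨
  degree a w                     ∎
  where open ≤-Reasoning

repeated-comm : ∀ {A : Set} {x y : A} {w} → Repeated x y w → Repeated y x w
repeated-comm (i , j , i<j , at±ᵢ , at±ⱼ) = i , j , i<j , swap at±ᵢ , swap at±ⱼ

degree-repeated-self : ∀ {σ} {w : Str σ} {x y} → Covering 2 σ w → Repeated x y w →
                       1 + δ x y + (σ + 1) ≤ degree x w
degree-repeated-self {σ} {w} {x} {y} cov rep = begin
  1 + δ x y + (σ + 1)                ≡⟨ cong (1 + δ x y +_) (∑-1+δ x) ⟨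
  1 + δ x y + ∑[ b < σ ] (1 + δ b x) ≤⟨ ∑-bump adjacent y pairCount-xy ⟩
  ∑[ b < σ ] pairCount x b w         ≡⟨ degree≡∑pairCount x w ⟨
  degree x w                         ∎
  where
  open ≤-Reasoning
  adjacent : ∀ b → 1 + δ b x ≤ pairCount x b w
  adjacent b = pairCount-adjacent (covering⇒adjacent cov x b)
  pairCount-xy : 1 + δ x y + (1 + δ y x) ≤ pairCount x y w
  pairCount-xy = begin
    1 + δ x y + (1 + δ y x)                 ≡⟨ cong (λ d → 1 + d + (1 + δ y x)) (δ-comm x y) ⟩
    1 + δ y x + (1 + δ y x)                 ≡⟨ cong₂ _+_ (pairWeight-diag x y) (pairWeight-diag x y) ⟨
    pairWeight x y x y + pairWeight x y x y ≤⟨ windowSum-repeated (pairWeight-comm x y) rep ⟩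
    pairCount x y w                         ∎

degree-repeated : ∀ {σ} {w : Str σ} {x y} → Covering 2 σ w → Repeated x y w →
                  ∀ a → σ + 1 + (δ a x + δ a y) ≤ degree a w
degree-repeated {σ} {w} {x} {y} cov rep a with a ≟ x
... | yes refl = subst (_≤ degree a w) (+-comm (1 + δ a y) (σ + 1)) (degree-repeated-self cov rep)
... | no _ with a ≟ y
...   | yes refl = begin
  σ + 1 + 1             ≡⟨ +-comm (σ + 1) 1 ⟩
  1 + (σ + 1)           ≤⟨ +-monoˡ-≤ (σ + 1) (m≤m+n 1 (δ a x)) ⟩
  1 + δ a x + (σ + 1)   ≤⟨ degree-repeated-self cov (repeated-comm rep) ⟩
  degree a w            ∎
  where open ≤-Reasoning
...   | no _     = subst (_≤ degree a w) (sym (+-identityʳ (σ + 1))) (degree-covering cov a)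

2*length≡∑degree+2 : ∀ {σ} (x : Fin σ) r → 2 * length (x ∷ r) ≡ ∑[ a < σ ] degree a (x ∷ r) + 2
2*length≡∑degree+2 x r =
  trans (*-suc 2 (length r)) (trans (+-comm 2 (2 * length r)) (cong (_+ 2) (sym (∑-degree x r))))

covering⇒length : ∀ {s} {w : Str (suc s)} → Covering 2 (suc s) w → suc s * (suc s + 1) + 2 ≤ 2 * length w
covering⇒length {s} {[]} cov = ⊥-elim (absurd (degree-covering cov zero))
  where
  absurd : ¬ (suc s + 1 ≤ 0)
  absurd ()
covering⇒length {s} {x ∷ r} cov = begin
  σ * (σ + 1) + 2                    ≡⟨ cong (_+ 2) (∑-const σ (σ + 1)) ⟨
  ∑[ a < σ ] (σ + 1) + 2             ≤⟨ +-monoˡ-≤ 2 (∑-mono-≤ (degree-covering cov)) ⟩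
  ∑[ a < σ ] degree a (x ∷ r) + 2    ≡⟨ 2*length≡∑degree+2 x r ⟨
  2 * length (x ∷ r)                 ∎
  where
  open ≤-Reasoning
  σ = suc s

repeated⇒length : ∀ {σ} {w : Str σ} {x y} → Covering 2 σ w → Repeated x y w →
                  σ * (σ + 1) + 2 + 2 ≤ 2 * length w
repeated⇒length {w = []}    cov (_ , _ , _ , inj₁ () , _)
repeated⇒length {w = []}    cov (_ , _ , _ , inj₂ () , _)
repeated⇒length {σ} {z ∷ r} {x} {y} cov rep = begin
  σ * (σ + 1) + 2 + 2                                   ≡⟨ cong (_+ 2) ∑-bound ⟨
  ∑[ a < σ ] (σ + 1 + (δ a x + δ a y)) + 2              ≤⟨ +-monoˡ-≤ 2 (∑-mono-≤ (degree-repeated cov rep)) ⟩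
  ∑[ a < σ ] degree a (z ∷ r) + 2                       ≡⟨ 2*length≡∑degree+2 z r ⟨
  2 * length (z ∷ r)                                    ∎
  where
  open ≤-Reasoning
  ∑-bound : ∑[ a < σ ] (σ + 1 + (δ a x + δ a y)) ≡ σ * (σ + 1) + 2
  ∑-bound = trans (∑-distrib-+ (λ _ → σ + 1) (λ a → δ a x + δ a y))
                  (cong₂ _+_ (∑-const σ (σ + 1)) (∑-δ+δ x y))

tight⇒PdB : ∀ {σ} {w : Str σ} → Covering 2 σ w → 2 * length w ≡ σ * (σ + 1) + 2 → PdB 2 σ w
tight⇒PdB {σ} cov tight p order≡2 with cov p order≡2
... | u , (xs , ys , refl) , pv≡p with pv≡order2⇒pair u pv≡p order≡2
...   | a , b , refl = length xs , subst (λ q → OccAt 2 w q (length xs)) pv≡p (windowAt⇒occAt at) , unique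
  where
  w = xs ++ a ∷ b ∷ ys
  at : WindowAt (length xs) w a b
  at = windowAt-++ xs
  ¬repeated : ¬ Repeated a b w
  ¬repeated rep =
    m+1+n≰m (σ * (σ + 1) + 2) (subst (σ * (σ + 1) + 2 + 2 ≤_) tight (repeated⇒length cov rep))
  unique : ∀ j → OccAt 2 w p j → j ≡ length xs
  unique j occ with occAt⇒windowAt occ | j ≟ℕ length xs
  ... | _ , _ , _   , _      | yes j≡i = j≡i
  ... | _ , _ , at′ , pv′≡p | no j≢i  =
    ⊥-elim (¬repeated (same-pv⇒repeated (j≢i ∘ sym) at at′ (trans pv′≡p (sym pv≡p))))

count-covering : ∀ {σ} {w : Str σ} → Covering 2 σ w → ∀ a → σ + 1 ≤ 2 * count a w
count-covering {w = w} cov a = ≤-trans (degree-covering cov a) (degree≤2*count a w)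

covering⇒length-even : ∀ {σ m} {w : Str σ} → σ ≡ 2 * m → Covering 2 σ w → σ * (m + 1) ≤ length w
covering⇒length-even {σ} {m} {w} σ≡2m cov = begin
  σ * (m + 1)             ≡⟨ ∑-const σ (m + 1) ⟨
  ∑[ a < σ ] (m + 1)      ≤⟨ ∑-mono-≤ m<count ⟩
  ∑[ a < σ ] count a w    ≡⟨ ∑-count w ⟩
  length w                ∎
  where
  open ≤-Reasoning
  m<count : ∀ a → m + 1 ≤ count a w
  m<count a = subst (_≤ count a w) (+-comm 1 m) (*-cancelˡ-< 2 m (count a w)
    (subst (_≤ 2 * count a w) (trans (cong (_+ 1) σ≡2m) (+-comm (2 * m) 1)) (count-covering cov a)))

substring-++ˡ : ∀ {σ} {u w : Str σ} xs → Substring u w → Substring u (xs ++ w)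
substring-++ˡ {u = u} xs (ys , zs , refl) = xs ++ ys , zs , sym (++-assoc xs ys (u ++ zs))

substring-++ʳ : ∀ {σ} {u w : Str σ} zs → Substring u w → Substring u (w ++ zs)
substring-++ʳ {u = u} zs (xs , ys , refl) =
  xs , ys ++ zs , trans (++-assoc xs (u ++ ys) zs) (cong (xs ++_) (++-assoc u ys zs))

substring-map : ∀ {σ τ} (f : Fin σ → Fin τ) {u w} → Substring u w → Substring (map f u) (map f w)
substring-map f {u} (xs , ys , refl) =
  map f xs , map f ys , trans (map-++ f xs (u ++ ys)) (cong (map f xs ++_) (map-++ f u ys))

adjacent-++ˡ : ∀ {σ} {a b : Fin σ} {w} xs → Adjacent a b w → Adjacent a b (xs ++ w)
adjacent-++ˡ xs = Sum.map (substring-++ˡ xs) (substring-++ˡ xs)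

adjacent-++ʳ : ∀ {σ} {a b : Fin σ} {w} zs → Adjacent a b w → Adjacent a b (w ++ zs)
adjacent-++ʳ zs = Sum.map (substring-++ʳ zs) (substring-++ʳ zs)

adjacent-map : ∀ {σ τ} (f : Fin σ → Fin τ) {a b w} → Adjacent a b w → Adjacent (f a) (f b) (map f w)
adjacent-map f = Sum.map (substring-map f) (substring-map f)

StartsWith : ∀ {A : Set} → A → List A → Set
StartsWith a w = ∃ λ r → w ≡ a ∷ r

EndsWith : ∀ {A : Set} → A → List A → Set
EndsWith a w = ∃ λ r → w ≡ r ++ a ∷ []

startsWith-++ : ∀ {A : Set} {a : A} {xs} ys → StartsWith a xs → StartsWith a (xs ++ ys)
startsWith-++ ys (r , refl) = r ++ ys , refl

endsWith-++ : ∀ {A : Set} {a : A} {ys} xs → EndsWith a ys → EndsWith a (xs ++ ys)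
endsWith-++ xs (r , refl) = xs ++ r , sym (++-assoc xs r _)

startsWith-map : ∀ {A B : Set} (f : A → B) {a w} → StartsWith a w → StartsWith (f a) (map f w)
startsWith-map f (r , refl) = map f r , refl

endsWith-map : ∀ {A B : Set} (f : A → B) {a w} → EndsWith a w → EndsWith (f a) (map f w)
endsWith-map f {a} (r , refl) = map f r , map-++ f r (a ∷ [])

adjacent-junction : ∀ {σ} {a b : Fin σ} {xs ys} → EndsWith a xs → StartsWith b ys →
                    Adjacent a b (xs ++ ys)
adjacent-junction {a = a} {b} (r , refl) (t , refl) = inj₁ (r , t , ++-assoc r (a ∷ []) (b ∷ t))

data _∈ₚ_ {A : Set} (k : A) : List (A × A) → Set where
  first  : ∀ {b P} → k ∈ₚ ((k , b) ∷ P)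
  second : ∀ {a P} → k ∈ₚ ((a , k) ∷ P)
  there  : ∀ {p P} → k ∈ₚ P → k ∈ₚ (p ∷ P)

mapPairs : ∀ {A B : Set} → (A → B) → List (A × A) → List (B × B)
mapPairs f = map (Product.map f f)

length-mapPairs : ∀ {A B : Set} (f : A → B) P → length (mapPairs f P) ≡ length P
length-mapPairs f = length-map (Product.map f f)

∈ₚ-map : ∀ {A B : Set} (f : A → B) {k P} → k ∈ₚ P → f k ∈ₚ mapPairs f P
∈ₚ-map f first       = first
∈ₚ-map f second      = second
∈ₚ-map f (there k∈P) = there (∈ₚ-map f k∈P)

weave : ∀ {σ} → Fin σ → Fin σ → List (Fin σ × Fin σ) → Str σ
weave u v []            = u ∷ []
weave u v ((a , b) ∷ P) = u ∷ a ∷ v ∷ b ∷ weave u v P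

weave-startsWith : ∀ {σ} (u v : Fin σ) P → StartsWith u (weave u v P)
weave-startsWith u v []      = [] , refl
weave-startsWith u v (_ ∷ _) = _ , refl

weave-endsWith : ∀ {σ} (u v : Fin σ) P → EndsWith u (weave u v P)
weave-endsWith u v []            = [] , refl
weave-endsWith u v ((a , b) ∷ P) = endsWith-++ (u ∷ a ∷ v ∷ b ∷ []) (weave-endsWith u v P)

weave-adjacent : ∀ {σ} (u v : Fin σ) {k P} → k ∈ₚ P →
                 Adjacent u k (weave u v P) × Adjacent v k (weave u v P)
weave-adjacent u v {P = (k , b) ∷ P} first = inj₁ ([] , _ , refl) , inj₂ (u ∷ [] , _ , refl)
weave-adjacent u v {P = (a , k) ∷ P} second =
  adjacent-comm (adjacent-++ˡ (u ∷ a ∷ v ∷ []) (adjacent-junction ([] , refl) (weave-startsWith u v P))) ,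
  inj₁ (u ∷ a ∷ [] , _ , refl)
weave-adjacent u v {P = p ∷ P} (there k∈P) =
  Product.map (adjacent-++ˡ (u ∷ _ ∷ v ∷ _ ∷ [])) (adjacent-++ˡ (u ∷ _ ∷ v ∷ _ ∷ []))
              (weave-adjacent u v k∈P)

length-weave : ∀ {σ} (u v : Fin σ) P → length (weave u v P) ≡ 1 + 4 * length P
length-weave u v []      = refl
length-weave u v (_ ∷ P) = trans (cong (4 +_) (length-weave u v P)) (cong suc (sym (*-suc 4 (length P))))

-- Optimal covering strings

-- Unlike 2 * suc n, twice (suc n) reduces to suc (suc (twice n)), as the
-- alphabets of the recursive constructions require.
twice : ℕ → ℕ
twice zero    = zero
twice (suc n) = suc (suc (twice n))

pairs : ∀ n → List (Fin (twice n) × Fin (twice n))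
pairs zero    = []
pairs (suc n) = (zero , suc zero) ∷ mapPairs (2 ↑ʳ_) (pairs n)

pairs-complete : ∀ n (k : Fin (twice n)) → k ∈ₚ pairs n
pairs-complete (suc n) zero          = first
pairs-complete (suc n) (suc zero)    = second
pairs-complete (suc n) (suc (suc k)) = there (∈ₚ-map (2 ↑ʳ_) (pairs-complete n k))

length-pairs : ∀ n → length (pairs n) ≡ n
length-pairs zero    = refl
length-pairs (suc n) = cong suc (trans (length-map _ (pairs n)) (length-pairs n))

length-weave-pairs : ∀ {σ} (u v : Fin σ) n (f : Fin (twice n) → Fin σ) →
                     length (weave u v (mapPairs f (pairs n))) ≡ 1 + 4 * n
length-weave-pairs u v n f =
  trans (length-weave u v (mapPairs f (pairs n)))
        (cong (λ k → 1 + 4 * k) (trans (length-mapPairs f (pairs n)) (length-pairs n)))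

oddWord : ∀ n → Str (suc (twice n))
oddWord zero    = zero ∷ zero ∷ []
oddWord (suc n) = zero ∷ zero ∷ suc zero ∷ suc zero ∷
                  map (2 ↑ʳ_) (oddWord n) ++ weave zero (suc zero) (mapPairs (3 ↑ʳ_) (pairs n))

oddWord-startsWith : ∀ n → StartsWith zero (oddWord n)
oddWord-startsWith zero    = _ , refl
oddWord-startsWith (suc n) = _ , refl

oddWord-endsWith : ∀ n → EndsWith zero (oddWord n)
oddWord-endsWith zero    = zero ∷ [] , refl
oddWord-endsWith (suc n) =
  endsWith-++ (zero ∷ zero ∷ suc zero ∷ suc zero ∷ map (2 ↑ʳ_) (oddWord n)) (weave-endsWith zero (suc zero) _)

oddWord-adjacent : ∀ n (a b : Fin (suc (twice n))) → Adjacent a b (oddWord n)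
oddWord-adjacent zero    zero zero = inj₁ ([] , [] , refl)
oddWord-adjacent (suc n) = adj
  where
  W = oddWord (suc n)
  prefix middle woven : Str (suc (twice (suc n)))
  prefix = zero ∷ zero ∷ suc zero ∷ suc zero ∷ []
  middle = map (2 ↑ʳ_) (oddWord n)
  woven  = weave zero (suc zero) (mapPairs (3 ↑ʳ_) (pairs n))

  in-middle : ∀ {a b} → Adjacent a b middle → Adjacent a b W
  in-middle = adjacent-++ˡ prefix ∘ adjacent-++ʳ woven

  in-woven : ∀ {a b} → Adjacent a b woven → Adjacent a b W
  in-woven = adjacent-++ˡ prefix ∘ adjacent-++ˡ middle

  hub : ∀ k → Adjacent zero (3 ↑ʳ k) W × Adjacent (suc zero) (3 ↑ʳ k) W
  hub k = Product.map in-woven in-woven (weave-adjacent zero (suc zero) (∈ₚ-map (3 ↑ʳ_) (pairs-complete n k)))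

  0-2 : Adjacent zero (suc (suc zero)) W
  0-2 = adjacent-comm (adjacent-++ˡ prefix (adjacent-junction {xs = middle} {ys = woven}
          (endsWith-map (2 ↑ʳ_) (oddWord-endsWith n)) (weave-startsWith zero (suc zero) _)))

  1-2 : Adjacent (suc zero) (suc (suc zero)) W
  1-2 = adjacent-junction {xs = prefix} {ys = middle ++ woven} (zero ∷ zero ∷ suc zero ∷ [] , refl)
          (startsWith-++ woven (startsWith-map (2 ↑ʳ_) (oddWord-startsWith n)))

  adj : ∀ a b → Adjacent a b W
  adj zero                zero                = inj₁ ([] , _ , refl)
  adj zero                (suc zero)          = inj₁ (zero ∷ [] , _ , refl)
  adj (suc zero)          zero                = inj₂ (zero ∷ [] , _ , refl)
  adj (suc zero)          (suc zero)          = inj₁ (zero ∷ zero ∷ [] , _ , refl)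
  adj zero                (suc (suc zero))    = 0-2
  adj (suc (suc zero))    zero                = adjacent-comm 0-2
  adj (suc zero)          (suc (suc zero))    = 1-2
  adj (suc (suc zero))    (suc zero)          = adjacent-comm 1-2
  adj zero                (suc (suc (suc k))) = proj₁ (hub k)
  adj (suc (suc (suc k))) zero                = adjacent-comm (proj₁ (hub k))
  adj (suc zero)          (suc (suc (suc k))) = proj₂ (hub k)
  adj (suc (suc (suc k))) (suc zero)          = adjacent-comm (proj₂ (hub k))
  adj (suc (suc i))       (suc (suc j))       = in-middle (adjacent-map (2 ↑ʳ_) (oddWord-adjacent n i j))

-- The suffix 2 3 1 supplies the pairs {0, 2} and {1, 3}, which no junction covers.
evenWord : ∀ n → Str (suc (suc (twice n)))
evenWord zero    = zero ∷ zero ∷ suc zero ∷ suc zero ∷ []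
evenWord (suc n) = zero ∷ zero ∷ suc zero ∷ suc zero ∷
                   map (2 ↑ʳ_) (evenWord n) ++ weave zero (suc zero) (mapPairs (4 ↑ʳ_) (pairs n)) ++
                   suc (suc zero) ∷ suc (suc (suc zero)) ∷ suc zero ∷ []

evenWord-startsWith : ∀ n → StartsWith zero (evenWord n)
evenWord-startsWith zero    = _ , refl
evenWord-startsWith (suc n) = _ , refl

evenWord-endsWith : ∀ n → EndsWith (suc zero) (evenWord n)
evenWord-endsWith zero    = zero ∷ zero ∷ suc zero ∷ [] , refl
evenWord-endsWith (suc n) =
  endsWith-++ (zero ∷ zero ∷ suc zero ∷ suc zero ∷ map (2 ↑ʳ_) (evenWord n))
    (endsWith-++ (weave zero (suc zero) (mapPairs (4 ↑ʳ_) (pairs n)))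
      (suc (suc zero) ∷ suc (suc (suc zero)) ∷ [] , refl))

evenWord-adjacent : ∀ n (a b : Fin (suc (suc (twice n)))) → Adjacent a b (evenWord n)
evenWord-adjacent zero    zero       zero       = inj₁ ([] , _ , refl)
evenWord-adjacent zero    zero       (suc zero) = inj₁ (zero ∷ [] , _ , refl)
evenWord-adjacent zero    (suc zero) zero       = inj₂ (zero ∷ [] , _ , refl)
evenWord-adjacent zero    (suc zero) (suc zero) = inj₁ (zero ∷ zero ∷ [] , _ , refl)
evenWord-adjacent (suc n) = adj
  where
  W = evenWord (suc n)
  prefix middle woven suffix : Str (suc (suc (twice (suc n))))
  prefix = zero ∷ zero ∷ suc zero ∷ suc zero ∷ []
  middle = map (2 ↑ʳ_) (evenWord n)
  woven  = weave zero (suc zero) (mapPairs (4 ↑ʳ_) (pairs n))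
  suffix = suc (suc zero) ∷ suc (suc (suc zero)) ∷ suc zero ∷ []

  in-middle : ∀ {a b} → Adjacent a b middle → Adjacent a b W
  in-middle = adjacent-++ˡ prefix ∘ adjacent-++ʳ (woven ++ suffix)

  in-woven++suffix : ∀ {a b} → Adjacent a b (woven ++ suffix) → Adjacent a b W
  in-woven++suffix = adjacent-++ˡ prefix ∘ adjacent-++ˡ middle

  hub : ∀ k → Adjacent zero (4 ↑ʳ k) W × Adjacent (suc zero) (4 ↑ʳ k) W
  hub k = Product.map (in-woven++suffix ∘ adjacent-++ʳ suffix) (in-woven++suffix ∘ adjacent-++ʳ suffix)
            (weave-adjacent zero (suc zero) (∈ₚ-map (4 ↑ʳ_) (pairs-complete n k)))

  0-2 : Adjacent zero (suc (suc zero)) W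
  0-2 = in-woven++suffix
          (adjacent-junction {xs = woven} {ys = suffix} (weave-endsWith zero (suc zero) _) (_ , refl))

  0-3 : Adjacent zero (suc (suc (suc zero))) W
  0-3 = adjacent-comm (adjacent-++ˡ prefix (adjacent-junction {xs = middle} {ys = woven ++ suffix}
          (endsWith-map (2 ↑ʳ_) (evenWord-endsWith n))
          (startsWith-++ suffix (weave-startsWith zero (suc zero) _))))

  1-2 : Adjacent (suc zero) (suc (suc zero)) W
  1-2 = adjacent-junction {xs = prefix} {ys = middle ++ woven ++ suffix} (zero ∷ zero ∷ suc zero ∷ [] , refl)
          (startsWith-++ (woven ++ suffix) (startsWith-map (2 ↑ʳ_) (evenWord-startsWith n)))

  1-3 : Adjacent (suc zero) (suc (suc (suc zero))) W
  1-3 = in-woven++suffix (adjacent-++ˡ woven (inj₂ (suc (suc zero) ∷ [] , [] , refl)))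

  adj : ∀ a b → Adjacent a b W
  adj zero                      zero                      = inj₁ ([] , _ , refl)
  adj zero                      (suc zero)                = inj₁ (zero ∷ [] , _ , refl)
  adj (suc zero)                zero                      = inj₂ (zero ∷ [] , _ , refl)
  adj (suc zero)                (suc zero)                = inj₁ (zero ∷ zero ∷ [] , _ , refl)
  adj zero                      (suc (suc zero))          = 0-2
  adj (suc (suc zero))          zero                      = adjacent-comm 0-2
  adj zero                      (suc (suc (suc zero)))    = 0-3
  adj (suc (suc (suc zero)))    zero                      = adjacent-comm 0-3
  adj (suc zero)                (suc (suc zero))          = 1-2
  adj (suc (suc zero))          (suc zero)                = adjacent-comm 1-2
  adj (suc zero)                (suc (suc (suc zero)))    = 1-3
  adj (suc (suc (suc zero)))    (suc zero)                = adjacent-comm 1-3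
  adj zero                      (suc (suc (suc (suc k)))) = proj₁ (hub k)
  adj (suc (suc (suc (suc k)))) zero                      = adjacent-comm (proj₁ (hub k))
  adj (suc zero)                (suc (suc (suc (suc k)))) = proj₂ (hub k)
  adj (suc (suc (suc (suc k)))) (suc zero)                = adjacent-comm (proj₂ (hub k))
  adj (suc (suc i))             (suc (suc j))             = in-middle (adjacent-map (2 ↑ʳ_) (evenWord-adjacent n i j))

length-oddWord : ∀ n → length (oddWord n) ≡ 2 * n * n + 3 * n + 2
length-oddWord zero    = refl
length-oddWord (suc n) = begin
  4 + length (middle ++ woven)        ≡⟨ cong (4 +_) (length-++ middle) ⟩
  4 + (length middle + length woven)  ≡⟨ cong₂ (λ p q → 4 + (p + q)) length-middle length-woven ⟩
  4 + ((2 * n * n + 3 * n + 2) + (1 + 4 * n))  ≡⟨ step n ⟩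
  2 * suc n * suc n + 3 * suc n + 2   ∎
  where
  open ≡-Reasoning
  middle = map (2 ↑ʳ_) (oddWord n)
  woven  = weave zero (suc zero) (mapPairs (3 ↑ʳ_) (pairs n))
  length-middle : length middle ≡ 2 * n * n + 3 * n + 2
  length-middle = trans (length-map _ (oddWord n)) (length-oddWord n)
  length-woven : length woven ≡ 1 + 4 * n
  length-woven = length-weave-pairs zero (suc zero) n (3 ↑ʳ_)
  step : ∀ n → 4 + ((2 * n * n + 3 * n + 2) + (1 + 4 * n)) ≡ 2 * (1 + n) * (1 + n) + 3 * (1 + n) + 2
  step = solve-∀

length-evenWord : ∀ n → length (evenWord n) ≡ 2 * n * n + 6 * n + 4
length-evenWord zero    = refl
length-evenWord (suc n) = begin
  4 + length (middle ++ woven ++ suffix)              ≡⟨ cong (4 +_) (length-++ middle) ⟩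
  4 + (length middle + length (woven ++ suffix))      ≡⟨ cong (λ q → 4 + (length middle + q)) (length-++ woven) ⟩
  4 + (length middle + (length woven + 3))            ≡⟨ cong₂ (λ p q → 4 + (p + (q + 3))) length-middle length-woven ⟩
  4 + ((2 * n * n + 6 * n + 4) + ((1 + 4 * n) + 3))   ≡⟨ step n ⟩
  2 * suc n * suc n + 6 * suc n + 4                   ∎
  where
  open ≡-Reasoning
  middle = map (2 ↑ʳ_) (evenWord n)
  woven  = weave zero (suc zero) (mapPairs (4 ↑ʳ_) (pairs n))
  suffix : Str (suc (suc (twice (suc n))))
  suffix = suc (suc zero) ∷ suc (suc (suc zero)) ∷ suc zero ∷ []
  length-middle : length middle ≡ 2 * n * n + 6 * n + 4
  length-middle = trans (length-map _ (evenWord n)) (length-evenWord n)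
  length-woven : length woven ≡ 1 + 4 * n
  length-woven = length-weave-pairs zero (suc zero) n (4 ↑ʳ_)
  step : ∀ n → 4 + ((2 * n * n + 6 * n + 4) + ((1 + 4 * n) + 3)) ≡ 2 * (1 + n) * (1 + n) + 6 * (1 + n) + 4
  step = solve-∀

2*[σ+1]C2 : ∀ σ → 2 * ((σ + 1) C 2) ≡ σ * (σ + 1)
2*[σ+1]C2 σ =
  trans (cong (λ n → 2 * (n C 2)) (+-comm σ 1)) (trans (2*[1+σ]C2 σ) (cong (σ *_) (+-comm 1 σ)))
  where
  2*[1+σ]C2 : ∀ σ → 2 * (suc σ C 2) ≡ σ * suc σ
  2*[1+σ]C2 zero    = refl
  2*[1+σ]C2 (suc σ) = begin
    2 * (suc (suc σ) C 2)             ≡⟨ cong (2 *_) (nCk+nC[k+1]≡[n+1]C[k+1] (suc σ) 1) ⟨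
    2 * (suc σ C 1 + suc σ C 2)       ≡⟨ *-distribˡ-+ 2 (suc σ C 1) (suc σ C 2) ⟩
    2 * (suc σ C 1) + 2 * (suc σ C 2) ≡⟨ cong₂ (λ a b → 2 * a + b) (nC1≡n (suc σ)) (2*[1+σ]C2 σ) ⟩
    2 * suc σ + σ * suc σ             ≡⟨ step σ ⟩
    suc σ * suc (suc σ)               ∎
    where
    open ≡-Reasoning
    step : ∀ σ → 2 * (1 + σ) + σ * (1 + σ) ≡ (1 + σ) * (1 + (1 + σ))
    step = solve-∀

excess≡⊖ : ∀ σ (w : Str σ) → excess 2 σ w ≡ length w ℤ.⊖ ((σ + 1) C 2 + 1)
excess≡⊖ σ w = trans (ℤ.m-n≡m⊖n (length w) ((σ + 2 ∸ 1) C 2 + 2 ∸ 1)) (cong (length w ℤ.⊖_) (begin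
  (σ + 2 ∸ 1) C 2 + 2 ∸ 1 ≡⟨ cong (λ n → n C 2 + 2 ∸ 1) (+-∸-assoc σ (s≤s z≤n)) ⟩
  (σ + 1) C 2 + 2 ∸ 1     ≡⟨ +-∸-assoc ((σ + 1) C 2) (s≤s z≤n) ⟩
  (σ + 1) C 2 + 1         ∎))
  where open ≡-Reasoning

shortest⇒minimalExcess : ∀ {σ m} → ShortestCoveringLength 2 σ ((σ + 1) C 2 + m) →
                         MinimalExcess 2 σ (ℤ.+ m ℤ.- ℤ.+ 1)
shortest⇒minimalExcess {σ} {m} ((w , cov , length≡) , lower) =
  (w , cov , trans (excess≡⊖ σ w) (trans (cong (ℤ._⊖ (c + 1)) length≡) [c+m]⊖[c+1])) ,
  λ w′ cov′ → subst₂ ℤ._≤_ [c+m]⊖[c+1] (sym (excess≡⊖ σ w′)) (ℤ.⊖-monoˡ-≤ (c + 1) (lower w′ cov′))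
  where
  c = (σ + 1) C 2
  [c+m]⊖[c+1] : (c + m) ℤ.⊖ (c + 1) ≡ ℤ.+ m ℤ.- ℤ.+ 1
  [c+m]⊖[c+1] = trans (ℤ.+-cancelˡ-⊖ c m 1) (sym (ℤ.m-n≡m⊖n m 1))

OddConclusion : ℕ → Set
OddConclusion σ = ShortestCoveringLength 2 σ (((σ + 1) C 2) + 1) × Σ (Str σ) (λ w → PdB 2 σ w)

EvenConclusion : ℕ → ℕ → Set
EvenConclusion σ m = ShortestCoveringLength 2 σ (((σ + 1) C 2) + m) × MinimalExcess 2 σ (ℤ.+ m ℤ.- ℤ.+ 1)

tight⇒oddConclusion : ∀ {s} (w : Str (suc s)) → Covering 2 (suc s) w →
                      2 * length w ≡ suc s * (suc s + 1) + 2 → OddConclusion (suc s)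
tight⇒oddConclusion {s} w cov tight =
  ((w , cov , *-cancelˡ-≡ _ _ 2 (trans tight (sym 2*L))) ,
   λ w′ cov′ → *-cancelˡ-≤ 2 (subst (_≤ 2 * length w′) (sym 2*L) (covering⇒length cov′))) ,
  w , tight⇒PdB cov tight
  where
  σ = suc s
  2*L : 2 * ((σ + 1) C 2 + 1) ≡ σ * (σ + 1) + 2
  2*L = trans (*-distribˡ-+ 2 ((σ + 1) C 2) 1) (cong (_+ 2) (2*[σ+1]C2 σ))

tight⇒evenConclusion : ∀ {σ m} (w : Str σ) → σ ≡ 2 * m → Covering 2 σ w → length w ≡ σ * (m + 1) →
                       EvenConclusion σ m
tight⇒evenConclusion {σ} {m} w σ≡2m cov length≡ = shortest , shortest⇒minimalExcess shortest
  where
  L≡ : (σ + 1) C 2 + m ≡ σ * (m + 1)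
  L≡ = *-cancelˡ-≡ _ _ 2 (begin
    2 * ((σ + 1) C 2 + m)         ≡⟨ *-distribˡ-+ 2 ((σ + 1) C 2) m ⟩
    2 * ((σ + 1) C 2) + 2 * m     ≡⟨ cong (_+ 2 * m) (2*[σ+1]C2 σ) ⟩
    σ * (σ + 1) + 2 * m           ≡⟨ cong (λ s → s * (s + 1) + 2 * m) σ≡2m ⟩
    2 * m * (2 * m + 1) + 2 * m   ≡⟨ step m ⟩
    2 * (2 * m * (m + 1))         ≡⟨ cong (λ s → 2 * (s * (m + 1))) σ≡2m ⟨
    2 * (σ * (m + 1))             ∎)
    where
    open ≡-Reasoning
    step : ∀ m → 2 * m * (2 * m + 1) + 2 * m ≡ 2 * (2 * m * (m + 1))
    step = solve-∀
  shortest : ShortestCoveringLength 2 σ ((σ + 1) C 2 + m)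
  shortest = (w , cov , trans length≡ (sym L≡)) ,
             λ w′ cov′ → subst (_≤ length w′) (sym L≡) (covering⇒length-even σ≡2m cov′)

1+twice≡2*+1 : ∀ n → suc (twice n) ≡ 2 * n + 1
1+twice≡2*+1 zero    = refl
1+twice≡2*+1 (suc n) = begin
  suc (suc (suc (twice n))) ≡⟨ cong (λ t → suc (suc t)) (1+twice≡2*+1 n) ⟩
  suc (suc (2 * n + 1))     ≡⟨ step n ⟩
  2 * suc n + 1             ∎
  where
  open ≡-Reasoning
  step : ∀ n → 2 + (2 * n + 1) ≡ 2 * (1 + n) + 1
  step = solve-∀

2+twice≡2*[1+] : ∀ n → suc (suc (twice n)) ≡ 2 * suc n
2+twice≡2*[1+] n =
  trans (cong suc (1+twice≡2*+1 n)) (trans (cong suc (+-comm (2 * n) 1)) (sym (*-suc 2 n)))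

oddWord-conclusion : ∀ n → OddConclusion (suc (twice n))
oddWord-conclusion n =
  tight⇒oddConclusion (oddWord n) (adjacent⇒covering (oddWord n) (oddWord-adjacent n)) (begin
  2 * length (oddWord n)                   ≡⟨ cong (2 *_) (length-oddWord n) ⟩
  2 * (2 * n * n + 3 * n + 2)              ≡⟨ step n ⟩
  (2 * n + 1) * ((2 * n + 1) + 1) + 2      ≡⟨ cong (λ t → t * (t + 1) + 2) (1+twice≡2*+1 n) ⟨
  suc (twice n) * (suc (twice n) + 1) + 2  ∎)
  where
  open ≡-Reasoning
  step : ∀ n → 2 * (2 * n * n + 3 * n + 2) ≡ (2 * n + 1) * ((2 * n + 1) + 1) + 2
  step = solve-∀

evenWord-conclusion : ∀ n → EvenConclusion (suc (suc (twice n))) (suc n)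
evenWord-conclusion n =
  tight⇒evenConclusion (evenWord n) (2+twice≡2*[1+] n)
    (adjacent⇒covering (evenWord n) (evenWord-adjacent n)) (begin
    length (evenWord n)                 ≡⟨ length-evenWord n ⟩
    2 * n * n + 6 * n + 4               ≡⟨ step n ⟩
    2 * suc n * (suc n + 1)             ≡⟨ cong (λ t → t * (suc n + 1)) (2+twice≡2*[1+] n) ⟨
    suc (suc (twice n)) * (suc n + 1)   ∎)
  where
  open ≡-Reasoning
  step : ∀ n → 2 * n * n + 6 * n + 4 ≡ 2 * (1 + n) * ((1 + n) + 1)
  step = solve-∀

-- Opened only here: the postfix +_ makes sections such as (c +_) ambiguous.
open import Data.Integer using (+_; _-_)

proposition4 : (σ : ℕ) → 3 ≤ σ →
    ((m : ℕ) → σ ≡ 2 * m + 1 →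
      ShortestCoveringLength 2 σ (((σ + 1) C 2) + 1) ×
      Σ (Str σ) (λ w → PdB 2 σ w)) ×
    ((m : ℕ) → σ ≡ 2 * m →
      ShortestCoveringLength 2 σ (((σ + 1) C 2) + m) ×
      MinimalExcess 2 σ (+ m - + 1))
proposition4 σ 3≤σ = odd , even
  where
  odd : ∀ m → σ ≡ 2 * m + 1 → OddConclusion σ
  odd m σ≡ = subst OddConclusion (trans (1+twice≡2*+1 m) (sym σ≡)) (oddWord-conclusion m)
  even : ∀ m → σ ≡ 2 * m → EvenConclusion σ m
  even zero    σ≡0 = ⊥-elim (<⇒≱ (s≤s z≤n) (subst (3 ≤_) σ≡0 3≤σ))
  even (suc n) σ≡  =
    subst (λ σ → EvenConclusion σ (suc n)) (trans (2+twice≡2*[1+] n) (sym σ≡)) (evenWord-conclusion n)
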